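{- Let $T(n) = \frac{n(n+1)}{2}$ for $n \geq 0$ and let $k \geq 0$ be an integer. Then for every positive integer $m < 2^{k+1}$ there exist integers $i, j$ with $0 \leq i < j \leq 2^k$ such that $m \mid T(j) - T(i)$. -}

module Defs where

open import Data.Nat using (ℕ; _*_; _+_; _/_)

T : ℕ → ℕ
T n = (n * (n + 1)) / 2

{-# OPTIONS --safe #-}
-- Since T j − T i = (j − i)(i + j + 1)/2, it suffices to split 2m into an even and an odd
-- factor and take the smaller one as j − i and the larger as i + j + 1. Writing
-- m = 2^a (2c + 1), the factors 2^(a+1) and 2c + 1 give j = 2^a + c, and
-- m < 2^(k+1) forces 2^a + c ≤ 2^k.
module Submission where

open import Defs
open import Data.Nat using (ℕ; zero; suc; _+_; _*_; _∸_; _^_; _/_; _<_; _≤_; _≤?_; z<s)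
open import Data.Nat.Divisibility using (_∣_; ∣-reflexive; divides-refl)
open import Data.Nat.DivMod using (+-distrib-/-∣ʳ; m*n/n≡m)
open import Data.Nat.Induction using (<-wellFounded)
open import Data.Nat.Properties
  using ( *-suc; *-identityˡ; *-identityʳ; *-assoc; +-identityʳ; +-comm; m<m+n; m≤m+n
        ; *-monoʳ-<; *-cancelˡ-≤; ≤-trans; ≤-reflexive; ≰⇒>; <⇒≱; m≤n⇒∃[o]m+o≡n
        ; m+n∸m≡n; ^-monoʳ-≤; m^n>0 )
open import Data.Nat.Tactic.RingSolver using (solve-∀)
open import Data.Product using (∃; ∃₂; _×_; _,_)
open import Data.Sum using (_⊎_; inj₁; inj₂)
open import Induction.WellFounded using (Acc; acc)
open import Relation.Binary.PropositionalEquality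
open import Relation.Nullary using (yes; no; contradiction)

T[i+d]≡T[i]+m : ∀ i d m → d * (2 * i + d + 1) ≡ m * 2 → T (i + d) ≡ T i + m
T[i+d]≡T[i]+m i d m eq = begin
  (i + d) * (i + d + 1) / 2        ≡⟨ cong (_/ 2) (trans (expand i d) (cong (i * (i + 1) +_) eq)) ⟩
  (i * (i + 1) + m * 2) / 2        ≡⟨ +-distrib-/-∣ʳ (i * (i + 1)) (divides-refl m) ⟩
  i * (i + 1) / 2 + m * 2 / 2      ≡⟨ cong (T i +_) (m*n/n≡m m 2) ⟩
  T i + m                          ∎
  where
  open ≡-Reasoning
  expand : ∀ i d → (i + d) * (i + d + 1) ≡ i * (i + 1) + d * (2 * i + d + 1)
  expand = solve-∀

odd-multiple-as-T-difference : ∀ P c → 0 < P →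
  ∃₂ λ i j → i < j × j ≡ P + c × T j ≡ T i + P * suc (2 * c)
odd-multiple-as-T-difference P c 0<P with P ≤? c
... | yes P≤c with m≤n⇒∃[o]m+o≡n P≤c
...   | e , refl =
  e , e + 2 * P , m<m+n e (*-monoʳ-< 2 0<P) , rearrange P e ,
  T[i+d]≡T[i]+m e (2 * P) _ (factors P e)
  where
  rearrange : ∀ P e → e + 2 * P ≡ P + (P + e)
  rearrange = solve-∀
  factors : ∀ P e → 2 * P * (2 * e + 2 * P + 1) ≡ P * suc (2 * (P + e)) * 2
  factors = solve-∀
odd-multiple-as-T-difference P c 0<P | no P≰c with m≤n⇒∃[o]m+o≡n (≰⇒> P≰c)
...   | e , refl =
  e , e + suc (2 * c) , m<m+n e z<s , rearrange c e ,
  T[i+d]≡T[i]+m e (suc (2 * c)) _ (factors c e)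
  where
  rearrange : ∀ c e → e + suc (2 * c) ≡ suc c + e + c
  rearrange = solve-∀
  factors : ∀ c e → suc (2 * c) * (2 * e + suc (2 * c) + 1) ≡ (suc c + e) * suc (2 * c) * 2
  factors = solve-∀

even-or-odd : ∀ n → ∃ λ q → n ≡ 2 * q ⊎ n ≡ suc (2 * q)
even-or-odd zero = 0 , inj₁ refl
even-or-odd (suc n) with even-or-odd n
... | q , inj₁ n≡2q = q , inj₂ (cong suc n≡2q)
... | q , inj₂ n≡1+2q = suc q , inj₁ (trans (cong suc n≡1+2q) (sym (*-suc 2 q)))

power-of-two-times-odd : ∀ m → 0 < m → ∃₂ λ a c → m ≡ 2 ^ a * suc (2 * c)
power-of-two-times-odd m = go m (<-wellFounded m)
  where
  go : ∀ m → Acc _<_ m → 0 < m → ∃₂ λ a c → m ≡ 2 ^ a * suc (2 * c)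
  go m (acc rec) 0<m with even-or-odd m
  ... | c , inj₂ refl = 0 , c , sym (*-identityˡ _)
  ... | suc q , inj₁ refl with go (suc q) (rec (m<m+n (suc q) z<s)) z<s
  ...   | a , c , q+1≡2^a*odd =
    suc a , c , trans (cong (2 *_) q+1≡2^a*odd) (sym (*-assoc 2 (2 ^ a) _))

2^m<2^[1+n]⇒2^m≤2^n : ∀ m n → 2 ^ m < 2 ^ suc n → 2 ^ m ≤ 2 ^ n
2^m<2^[1+n]⇒2^m≤2^n m n lt with m ≤? n
... | yes m≤n = ^-monoʳ-≤ 2 m≤n
... | no m≰n = contradiction (^-monoʳ-≤ 2 (≰⇒> m≰n)) (<⇒≱ lt)

odd-multiple-bound : ∀ P c K → 0 < P → 0 < c → P * suc (2 * c) < 2 * K → P + c ≤ K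
odd-multiple-bound (suc R) (suc e) K _ _ lt =
  *-cancelˡ-≤ 2 (≤-trans (m≤m+n _ _) (≤-trans (≤-reflexive (expand R e)) lt))
  where
  expand : ∀ R e → 2 * (suc R + suc e) + R * suc (2 * e) ≡ suc (suc R * suc (2 * suc e))
  expand = solve-∀

power-of-two-times-odd-bound : ∀ a c k → 2 ^ a * suc (2 * c) < 2 ^ suc k → 2 ^ a + c ≤ 2 ^ k
power-of-two-times-odd-bound a zero k lt rewrite +-identityʳ (2 ^ a) | *-identityʳ (2 ^ a) =
  2^m<2^[1+n]⇒2^m≤2^n a k lt
power-of-two-times-odd-bound a c@(suc _) k lt = odd-multiple-bound (2 ^ a) c (2 ^ k) (m^n>0 2 a) z<s lt

lemma9 : ∀ (k m : ℕ) → 0 < m → m < 2 ^ (k + 1) →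
    ∃₂ λ i j → i < j × j ≤ 2 ^ k × m ∣ (T j ∸ T i)
lemma9 k m 0<m m<2^[k+1] with power-of-two-times-odd m 0<m
... | a , c , refl with odd-multiple-as-T-difference (2 ^ a) c (m^n>0 2 a)
... | i , j , i<j , refl , Tj≡Ti+m =
  i , j , i<j ,
  power-of-two-times-odd-bound a c k (subst (λ n → 2 ^ a * suc (2 * c) < 2 ^ n) (+-comm k 1) m<2^[k+1]) ,
  ∣-reflexive (sym (trans (cong (_∸ T i) Tj≡Ti+m) (m+n∸m≡n (T i) _)))
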